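{- Let $p,q,z$ be positive integers with $2<p<q$ and $q=2^z$, let $n=pq$, let $t=\log_n p$ and $k=p=n^t$. Let $V=\{1,\dots,n\}=\mathcal{V}_1\cup\mathcal{V}_2$ with $\mathcal{V}_1=\{1,\dots,n-q\}$ and $\mathcal{V}_2=\{n-q+1,\dots,n\}$. For $0\le r\le q-1$ let $V_r=\{i\in V:(i-1)\bmod q=r\}$. Let $E_1$ be the set of all $k$-subsets of $\mathcal{V}_1$; let $E_2$ be the set of all $k$-subsets of $V$ consisting of $k-1$ vertices of $\mathcal{V}_1$ and one vertex of $\mathcal{V}_2$; let $E_3$ be the set of all $k$-subsets of $V$ contained in some $V_r$. Let $G(V,E)$ be the $k$-uniform hypergraph with $E=(E_1\cup E_2)\setminus E_3$. Then (i) $\chi^c(G)=\lceil\log_2 n^{1-t}\rceil$, (ii) $\alpha(G)=n^{1-t}+n^t-2$, and (iii) $\gamma(G)=n^t$.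
   Context: A set $I\subseteq V$ is independent if it contains no hyperedge; $\alpha(G)$ is the maximum size of an independent set. A bicoloring of $G$ is a map $X:V\to\{0,1\}$; a bicoloring cover of $G$ is a set of bicolorings such that every hyperedge is non-monochromatic under at least one of them; $\chi^c(G)$ is the minimum size of a bicoloring cover. For an optimal bicoloring cover $C=\{X_1,\dots,X_{\chi^c(G)}\}$, each vertex $v$ gets the color bit vector $(X_1(v),\dots,X_{\chi^c(G)}(v))$, and $\gamma_C(G)$ is the maximum number of vertices sharing a common bit vector. The cover independence number $\gamma(G)$ is the maximum of $\gamma_C(G)$ over all bicoloring covers $C$ of size $\chi^c(G)$. -}

module Defs where

open import Data.Nat using (ℕ; _<_; _≤_; _∸_; NonZero)
open import Data.Nat.DivMod using (_%_)
open import Data.Bool using (Bool)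
open import Data.Fin using (Fin; toℕ)
open import Data.Fin.Subset using (Subset; _∈_; _⊆_; ∣_∣)
open import Data.Product using (Σ; ∃; ∃-syntax; _×_)
open import Data.Sum using (_⊎_)
open import Relation.Nullary using (¬_)
open import Relation.Binary.PropositionalEquality using (_≡_; _≢_)

Hypergraph : ℕ → Set₁
Hypergraph n = Subset n → Set

Independent : ∀ {n} → Hypergraph n → Subset n → Set
Independent E I = ∀ e → E e → ¬ (e ⊆ I)

IsIndependenceNumber : ∀ {n} → Hypergraph n → ℕ → Set
IsIndependenceNumber {n} E a =
  (∃[ I ] (Independent E I × ∣ I ∣ ≡ a)) ×
  (∀ (I : Subset n) → Independent E I → ∣ I ∣ ≤ a)

Bicoloring : ℕ → Set
Bicoloring n = Fin n → Bool

NonMonochromatic : ∀ {n} → Bicoloring n → Subset n → Set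
NonMonochromatic X e = ∃[ u ] ∃[ v ] (u ∈ e × v ∈ e × X u ≢ X v)

IsBicoloringCover : ∀ {n} → Hypergraph n → (m : ℕ) → (Fin m → Bicoloring n) → Set
IsBicoloringCover E m C = ∀ e → E e → ∃[ i ] NonMonochromatic (C i) e

IsCoverNumber : ∀ {n} → Hypergraph n → ℕ → Set
IsCoverNumber {n} E c =
  (∃[ C ] IsBicoloringCover E c C) ×
  (∀ (m : ℕ) (C : Fin m → Bicoloring n) → IsBicoloringCover E m C → c ≤ m)

SameBitVector : ∀ {n m} → (Fin m → Bicoloring n) → Subset n → Set
SameBitVector C S = ∀ u v → u ∈ S → v ∈ S → ∀ i → C i u ≡ C i v

-- g = γ(G): max over optimal covers C of γ_C(G)
IsCoverIndependenceNumber : ∀ {n} → Hypergraph n → ℕ → Set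
IsCoverIndependenceNumber {n} E g =
  ∀ (c : ℕ) → IsCoverNumber E c →
    (∃[ C ] ∃[ S ] (IsBicoloringCover E c C × SameBitVector C S × ∣ S ∣ ≡ g)) ×
    (∀ (C : Fin c → Bicoloring n) (S : Subset n) →
       IsBicoloringCover E c C → SameBitVector C S → ∣ S ∣ ≤ g)

-- The construction. Vertex j : Fin n stands for paper vertex j+1.
-- V1 = {1..n-q} ↔ toℕ j < n ∸ q ; V_r ↔ toℕ j % q ≡ r.
InV1 : ∀ {n} → ℕ → Fin n → Set
InV1 {n} q j = toℕ j < n ∸ q

E1 : (n q k : ℕ) → Hypergraph n
E1 n q k S = ∣ S ∣ ≡ k × (∀ j → j ∈ S → InV1 q j)

E2 : (n q k : ℕ) → Hypergraph n
E2 n q k S = ∣ S ∣ ≡ k ×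
  (∃[ v ] (v ∈ S × ¬ InV1 q v × (∀ w → w ∈ S → ¬ InV1 q w → w ≡ v)))

E3 : (n q k : ℕ) .{{_ : NonZero q}} → Hypergraph n
E3 n q k S = ∣ S ∣ ≡ k × (∃[ r ] (r < q × (∀ j → j ∈ S → toℕ j % q ≡ r)))

Gq : (n q k : ℕ) .{{_ : NonZero q}} → Hypergraph n
Gq n q k S = (E1 n q k S ⊎ E2 n q k S) × ¬ E3 n q k S

module Submission where

-- View vertex j as the cell (⌊j/q⌋, j mod q) of a p × q grid: V1 is the first p-1 rows, V2 the
-- last row, and the residue classes are the columns. Two facts drive everything:
--  (a) an independent set inside V1 has ≤ p-1 vertices: any p of them form an E1 edge, since a
--      column meets V1 in only p-1 cells;
--  (b) if an independent K has p-1 vertices in V1, each vertex of K ∩ V2 shares their column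
--      (else it completes them to an E2 edge), and a column meets V2 once, so |K ∩ V2| ≤ 1.
-- So an independent set has ≤ p vertices or ≤ p-2 in V1; α follows. The colour classes of a
-- bicoloring cover are independent; counting V1 over the ≤ 2^m classes with (a) gives
-- (p-1)q ≤ 2^m(p-1), so m ≥ z, and the binary digits of the column give a cover of size z. With
-- z colourings this count forces p-1 vertices of V1 into every class, so each class has ≤ p
-- vertices, and a column attains p. The file develops subsets, counting by fibres and bit-vector
-- codes of colourings in general, then the construction, and ends with the theorem.

open import Defs
open import Data.Nat using (ℕ; zero; suc; _<_; _≤_; z<s; s≤s⁻¹; _+_; _*_; _∸_; _^_; z≤n; s≤s; NonZero; _≟_; _<?_)
open import Data.Nat.Properties
open import Algebra.Properties.CommutativeSemigroup +-commutativeSemigroup using (interchange)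
open import Data.Nat.Logarithm using (⌈log₂_⌉; ⌈log₂2^n⌉≡n)
open import Data.Nat.DivMod using (_%_; _/_; _mod_; m≡m%n+[m/n]*n; m<n*o⇒m/o<n; [m+kn]%n≡m%n; m<n⇒m%n≡m; m%n<n)
open import Data.Bool using (Bool; true; false; if_then_else_)
import Data.Fin as Fin
open import Data.Fin using (Fin; toℕ; funToFin; finToFun)
open import Data.Fin.Properties using (any?; toℕ-injective; toℕ-fromℕ<; toℕ<n; funToFin-finToFin; finToFun-funToFin; 2↔Bool)
open import Data.Fin.Subset using (Subset; _∈_; _∉_; _⊆_; ∣_∣; _∩_; _∪_; ∁; ⁅_⁆; ⊤; Nonempty; Empty)
open import Data.Fin.Subset.Properties
  using ( _∈?_; nonempty?; Empty-unique; ∣⊥∣≡0; ∣⊤∣≡n; ∣⁅x⁆∣≡1; x∈⁅x⁆; x∈⁅y⁆⇒x≡y; ∣∁p∣≡n∸∣p∣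
        ; x∈∁p⇒x∉p; x∈p⇒x∉∁p; p⊆q⇒∣p∣≤∣q∣; ∩-comm; p∩q⊆p; p∩q⊆q; x∈p∩q⁻; ∣p∩q∣≤∣q∣
        ; x∈p∪q⁻; x∈p∪q⁺ )
open import Data.Vec using ([]; _∷_; tabulate; here; there)
open import Data.Vec.Properties using (lookup∘tabulate; []=⇒lookup; lookup⇒[]=)
open import Data.Product using (∃-syntax; _×_; _,_; proj₁; proj₂)
open import Data.Sum using (_⊎_; inj₁; inj₂)
open import Data.Bool.Properties using () renaming (_≟_ to _≟ᵇ_)
open import Function using (_∘_; Inverse)
open import Level using (0ℓ)
open import Relation.Nullary using (¬_; Dec; yes; no; does; contradiction)
open import Relation.Nullary.Decidable using (dec-true; decidable-stable; ¬?; _×-dec_)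
open import Relation.Unary using (Pred; Decidable)
open import Relation.Binary.PropositionalEquality

-- Finite sets: comprehension, splitting and choosing subsets.
module Subsets where

  private variable
    n : ℕ

  ⟦_⟧ : {P : Pred (Fin n) 0ℓ} → Decidable P → Subset n
  ⟦ P? ⟧ = tabulate (does ∘ P?)

  ∈⟦⟧⁺ : {P : Pred (Fin n) 0ℓ} (P? : Decidable P) {j : Fin n} → P j → j ∈ ⟦ P? ⟧
  ∈⟦⟧⁺ P? {j} pj = lookup⇒[]= j _ (trans (lookup∘tabulate (does ∘ P?) j) (dec-true (P? j) pj))

  ∈⟦⟧⁻ : {P : Pred (Fin n) 0ℓ} (P? : Decidable P) {j : Fin n} → j ∈ ⟦ P? ⟧ → P j
  ∈⟦⟧⁻ P? {j} j∈ = witness (P? j) (trans (sym (lookup∘tabulate (does ∘ P?) j)) ([]=⇒lookup j∈))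
    where
      witness : ∀ {A : Set} (A? : Dec A) → does A? ≡ true → A
      witness (yes a) _ = a

  ∣∩∣+∣∩∁∣ : (S A : Subset n) → ∣ S ∣ ≡ ∣ S ∩ A ∣ + ∣ S ∩ ∁ A ∣
  ∣∩∣+∣∩∁∣ []          []          = refl
  ∣∩∣+∣∩∁∣ (false ∷ S) (_ ∷ A)     = ∣∩∣+∣∩∁∣ S A
  ∣∩∣+∣∩∁∣ (true ∷ S)  (true ∷ A)  = cong suc (∣∩∣+∣∩∁∣ S A)
  ∣∩∣+∣∩∁∣ (true ∷ S)  (false ∷ A) = trans (cong suc (∣∩∣+∣∩∁∣ S A)) (sym (+-suc _ _))

  ∣∪∣-disjoint : (A B : Subset n) → (∀ {j} → j ∈ A → j ∉ B) → ∣ A ∪ B ∣ ≡ ∣ A ∣ + ∣ B ∣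
  ∣∪∣-disjoint []          []          _ = refl
  ∣∪∣-disjoint (true ∷ A)  (true ∷ B)  d = contradiction here (d here)
  ∣∪∣-disjoint (true ∷ A)  (false ∷ B) d =
    cong suc (∣∪∣-disjoint A B λ j∈A j∈B → d (there j∈A) (there j∈B))
  ∣∪∣-disjoint (false ∷ A) (true ∷ B)  d =
    trans (cong suc (∣∪∣-disjoint A B λ j∈A j∈B → d (there j∈A) (there j∈B))) (sym (+-suc _ _))
  ∣∪∣-disjoint (false ∷ A) (false ∷ B) d = ∣∪∣-disjoint A B λ j∈A j∈B → d (there j∈A) (there j∈B)

  choose : (S : Subset n) (k : ℕ) → k ≤ ∣ S ∣ → ∃[ T ] (T ⊆ S × ∣ T ∣ ≡ k)
  choose []          zero    _       = [] , (λ ()) , refl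
  choose (false ∷ S) k       k≤∣S∣   with choose S k k≤∣S∣
  ... | T , T⊆S , ∣T∣ = false ∷ T , (λ { (there j∈T) → there (T⊆S j∈T) }) , ∣T∣
  choose (true ∷ S)  zero    _       with choose S zero z≤n
  ... | T , T⊆S , ∣T∣ = false ∷ T , (λ { (there j∈T) → there (T⊆S j∈T) }) , ∣T∣
  choose (true ∷ S)  (suc k) (s≤s k≤∣S∣) with choose S k k≤∣S∣
  ... | T , T⊆S , ∣T∣ =
    true ∷ T , (λ { here → here ; (there j∈T) → there (T⊆S j∈T) }) , cong suc ∣T∣

  ∣Empty∣≡0 : {S : Subset n} → Empty S → ∣ S ∣ ≡ 0
  ∣Empty∣≡0 {n} empty = trans (cong ∣_∣ (Empty-unique empty)) (∣⊥∣≡0 n)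

  nonempty : (S : Subset n) → 0 < ∣ S ∣ → Nonempty S
  nonempty S 0<∣S∣ with nonempty? S
  ... | yes ne    = ne
  ... | no  empty = contradiction (∣Empty∣≡0 empty) (>⇒≢ 0<∣S∣)

  ∣S∣≤1 : (S : Subset n) → (∀ {u v} → u ∈ S → v ∈ S → u ≡ v) → ∣ S ∣ ≤ 1
  ∣S∣≤1 S same with nonempty? S
  ... | no  empty    = ≤-trans (≤-reflexive (∣Empty∣≡0 empty)) z≤n
  ... | yes (u , u∈S) = subst (∣ S ∣ ≤_) (∣⁅x⁆∣≡1 u)
    (p⊆q⇒∣p∣≤∣q∣ λ v∈S → subst (_∈ ⁅ u ⁆) (same u∈S v∈S) (x∈⁅x⁆ u))

  ∣below∣ : ∀ k → k ≤ n → ∣ ⟦ (λ (j : Fin n) → toℕ j <? k) ⟧ ∣ ≡ k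
  ∣below∣ {zero}  zero    _         = refl
  ∣below∣ {suc n} zero    _         = ∣below∣ {n} zero z≤n
  ∣below∣ {suc n} (suc k) (s≤s k≤n) = cong suc (∣below∣ k k≤n)

  ∪⁅⁆⊆ : {W K : Subset n} {u : Fin n} → W ⊆ K → u ∈ K → W ∪ ⁅ u ⁆ ⊆ K
  ∪⁅⁆⊆ {W = W} {u = u} W⊆K u∈K j∈ with x∈p∪q⁻ W ⁅ u ⁆ j∈
  ... | inj₁ j∈W   = W⊆K j∈W
  ... | inj₂ j∈⁅u⁆ = subst (_∈ _) (sym (x∈⁅y⁆⇒x≡y u j∈⁅u⁆)) u∈K

open Subsets

-- Finite sums and counting by fibres.
module Fibres where

  private variable
    n : ℕ

  ∑ : ℕ → (ℕ → ℕ) → ℕ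
  ∑ zero    d = 0
  ∑ (suc K) d = d 0 + ∑ K (d ∘ suc)

  ∑-cong : ∀ K {d e : ℕ → ℕ} → (∀ c → d c ≡ e c) → ∑ K d ≡ ∑ K e
  ∑-cong zero    d≗e = refl
  ∑-cong (suc K) d≗e = cong₂ _+_ (d≗e 0) (∑-cong K (d≗e ∘ suc))

  ∑-+ : ∀ K (d e : ℕ → ℕ) → ∑ K (λ c → d c + e c) ≡ ∑ K d + ∑ K e
  ∑-+ zero    d e = refl
  ∑-+ (suc K) d e = trans (cong (d 0 + e 0 +_) (∑-+ K (d ∘ suc) (e ∘ suc)))
                          (interchange (d 0) (e 0) (∑ K (d ∘ suc)) (∑ K (e ∘ suc)))

  ∑-≤ : ∀ K (d : ℕ → ℕ) {b} → (∀ c → c < K → d c ≤ b) → ∑ K d ≤ K * b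
  ∑-≤ zero    d bound = z≤n
  ∑-≤ (suc K) d bound = +-mono-≤ (bound 0 z<s) (∑-≤ K (d ∘ suc) λ c c<K → bound (suc c) (s≤s c<K))

  ∑-< : ∀ K (d : ℕ → ℕ) {b c₀} → (∀ c → c < K → d c ≤ b) → c₀ < K → d c₀ < b → ∑ K d < K * b
  ∑-< (suc K) d bound (s≤s z≤n) d₀<b =
    +-mono-<-≤ d₀<b (∑-≤ K (d ∘ suc) λ c c<K → bound (suc c) (s≤s c<K))
  ∑-< (suc K) d {c₀ = suc c₀} bound (s≤s c₀<K) dc₀<b =
    +-mono-≤-< (bound 0 z<s) (∑-< K (d ∘ suc) (λ c c<K → bound (suc c) (s≤s c<K)) c₀<K dc₀<b)

  ind : Bool → ℕ
  ind b = if b then 1 else 0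

  ∣∷∣ : (b : Bool) (S : Subset n) → ∣ b ∷ S ∣ ≡ ind b + ∣ S ∣
  ∣∷∣ true  S = refl
  ∣∷∣ false S = refl

  ∑-zero : ∀ K → ∑ K (λ _ → 0) ≡ 0
  ∑-zero zero    = refl
  ∑-zero (suc K) = ∑-zero K

  ∑-point : ∀ K {a} → a < K → ∑ K (λ c → ind (does (a ≟ c))) ≡ 1
  ∑-point (suc K) {zero}  _         = cong suc (∑-zero K)
  ∑-point (suc K) {suc a} (s≤s a<K) = ∑-point K a<K

  fibre : (Fin n → ℕ) → ℕ → Subset n
  fibre f c = ⟦ (λ j → f j ≟ c) ⟧

  ∣S∣≡∑fibres : ∀ K (f : Fin n → ℕ) (S : Subset n) → (∀ {j} → j ∈ S → f j < K) →
                ∣ S ∣ ≡ ∑ K (λ c → ∣ S ∩ fibre f c ∣)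
  ∣S∣≡∑fibres K f []          _       = sym (∑-zero K)
  ∣S∣≡∑fibres K f (false ∷ S) f<K     = ∣S∣≡∑fibres K (f ∘ Fin.suc) S (f<K ∘ there)
  ∣S∣≡∑fibres K f (true ∷ S)  f<K     = begin
    1 + ∣ S ∣                           ≡⟨ cong₂ _+_ (∑-point K (f<K here)) (sym rest-sum) ⟨
    ∑ K hits-0 + ∑ K (∣_∣ ∘ rest)       ≡⟨ ∑-+ K hits-0 (∣_∣ ∘ rest) ⟨
    ∑ K (λ c → hits-0 c + ∣ rest c ∣)  ≡⟨ ∑-cong K (λ c → ∣∷∣ (does (f Fin.zero ≟ c)) (rest c)) ⟨
    ∑ K (λ c → ∣ (true ∷ S) ∩ fibre f c ∣) ∎
    where
      open ≡-Reasoning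
      hits-0 : ℕ → ℕ
      hits-0 c = ind (does (f Fin.zero ≟ c))
      rest : ℕ → Subset _
      rest c = S ∩ fibre (f ∘ Fin.suc) c
      rest-sum : ∣ S ∣ ≡ ∑ K (∣_∣ ∘ rest)
      rest-sum = ∣S∣≡∑fibres K (f ∘ Fin.suc) S (f<K ∘ there)

  fibre-bound : ∀ K (f : Fin n → ℕ) (S : Subset n) {b} → (∀ {j} → j ∈ S → f j < K) →
                (∀ c → c < K → ∣ S ∩ fibre f c ∣ ≤ b) → ∣ S ∣ ≤ K * b
  fibre-bound K f S f<K bound = ≤-trans (≤-reflexive (∣S∣≡∑fibres K f S f<K)) (∑-≤ K _ bound)

  fibre-full : ∀ K (f : Fin n → ℕ) (S : Subset n) {b} → (∀ {j} → j ∈ S → f j < K) →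
               (∀ c → c < K → ∣ S ∩ fibre f c ∣ ≤ b) → K * b ≤ ∣ S ∣ →
               ∀ {c} → c < K → b ≤ ∣ S ∩ fibre f c ∣
  fibre-full K f S f<K bound K*b≤∣S∣ c<K = ≮⇒≥ λ deficient →
    <⇒≱ (∑-< K _ bound c<K deficient) (≤-trans K*b≤∣S∣ (≤-reflexive (∣S∣≡∑fibres K f S f<K)))

  injective-bound : ∀ K (f : Fin n → ℕ) (S : Subset n) → (∀ {j} → j ∈ S → f j < K) →
                    (∀ {u v} → u ∈ S → v ∈ S → f u ≡ f v → u ≡ v) → ∣ S ∣ ≤ K
  injective-bound K f S f<K injective =
    subst (∣ S ∣ ≤_) (*-identityʳ K) (fibre-bound K f S f<K λ c _ → ∣S∣≤1 _ λ u∈ v∈ →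
      let (u∈S , fu≡c) = x∈p∩q⁻ S (fibre f c) u∈
          (v∈S , fv≡c) = x∈p∩q⁻ S (fibre f c) v∈
      in injective u∈S v∈S (trans (∈⟦⟧⁻ (λ j → f j ≟ c) fu≡c) (sym (∈⟦⟧⁻ (λ j → f j ≟ c) fv≡c))))

  -- Vertices below c·q with a common remainder mod q number at most c:
  -- their quotients by q are distinct and below c.
  congruent-bound : ∀ q .{{_ : NonZero q}} c r (T : Subset n) →
                    (∀ {j} → j ∈ T → toℕ j < c * q) → (∀ {j} → j ∈ T → toℕ j % q ≡ r) → ∣ T ∣ ≤ c
  congruent-bound q c r T below residue =
    injective-bound c (λ j → toℕ j / q) T (m<n*o⇒m/o<n ∘ below) λ {u} {v} u∈T v∈T quot → toℕ-injective (begin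
      toℕ u                      ≡⟨ m≡m%n+[m/n]*n (toℕ u) q ⟩
      toℕ u % q + toℕ u / q * q  ≡⟨ cong₂ (λ x y → x + y * q) (trans (residue u∈T) (sym (residue v∈T))) quot ⟩
      toℕ v % q + toℕ v / q * q  ≡⟨ m≡m%n+[m/n]*n (toℕ v) q ⟨
      toℕ v                      ∎)
    where open ≡-Reasoning

open Fibres

-- Colourings: m colours at a vertex form a bit vector, i.e. a number below 2^m.
module Colourings where

  private variable
    n : ℕ

  independent-⊆ : (E : Hypergraph n) {S T : Subset n} → T ⊆ S → Independent E S → Independent E T
  independent-⊆ E T⊆S independent e edge e⊆T = independent e edge (T⊆S ∘ e⊆T)

  open Inverse 2↔Bool using ()
    renaming (to to toBool; from to fromBool; strictlyInverseˡ to toBool∘fromBool; strictlyInverseʳ to fromBool∘toBool)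

  -- Bit vectors of length m are numbers below 2^m: encode and digits are the two halves of the
  -- library bijection Fin (2^m) ≅ (Fin m → Fin 2), composed with Fin 2 ≅ Bool.
  encode : ∀ {m} → (Fin m → Bool) → Fin (2 ^ m)
  encode X = funToFin (fromBool ∘ X)

  digits : ∀ m → Fin (2 ^ m) → Fin m → Bool
  digits m a = toBool ∘ finToFun a

  digits-encode : ∀ {m} (X : Fin m → Bool) i → digits m (encode X) i ≡ X i
  digits-encode X i = trans (cong toBool (finToFun-funToFin (fromBool ∘ X) i)) (toBool∘fromBool (X i))

  funToFin-cong : ∀ {k l} {f g : Fin k → Fin l} → (∀ i → f i ≡ g i) → funToFin f ≡ funToFin g
  funToFin-cong {zero}  _   = refl
  funToFin-cong {suc k} f≗g = cong₂ Fin.combine (f≗g Fin.zero) (funToFin-cong (f≗g ∘ Fin.suc))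

  encode-cong : ∀ {m} {X Y : Fin m → Bool} → (∀ i → X i ≡ Y i) → encode X ≡ encode Y
  encode-cong same = funToFin-cong (cong fromBool ∘ same)

  encode-digits : ∀ m (a : Fin (2 ^ m)) → encode (digits m a) ≡ a
  encode-digits m a =
    trans (funToFin-cong {m} (fromBool∘toBool ∘ finToFun {2} {m} a)) (funToFin-finToFin {m} {2} a)

  digits-injective : ∀ m {a b : Fin (2 ^ m)} → (∀ i → digits m a i ≡ digits m b i) → a ≡ b
  digits-injective m {a} {b} same = begin
    a                            ≡⟨ encode-digits m a ⟨
    encode (digits m a)          ≡⟨ encode-cong same ⟩
    encode (digits m b)          ≡⟨ encode-digits m b ⟩
    b                            ∎
    where open ≡-Reasoning

  code : ∀ {m} → (Fin m → Bicoloring n) → Fin n → ℕ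
  code C j = toℕ (encode (λ i → C i j))

  code<2^m : ∀ {m} (C : Fin m → Bicoloring n) j → code C j < 2 ^ m
  code<2^m C j = toℕ<n _

  code-injective : ∀ {m} (C : Fin m → Bicoloring n) {u v} → code C u ≡ code C v → ∀ i → C i u ≡ C i v
  code-injective {m = m} C {u} {v} same i = begin
    C i u                              ≡⟨ digits-encode (λ i → C i u) i ⟨
    digits m (encode (λ i → C i u)) i  ≡⟨ cong (λ x → digits m x i) (toℕ-injective same) ⟩
    digits m (encode (λ i → C i v)) i  ≡⟨ digits-encode (λ i → C i v) i ⟩
    C i v                              ∎
    where open ≡-Reasoning

  code-cong : ∀ {m} (C : Fin m → Bicoloring n) {u v} → (∀ i → C i u ≡ C i v) → code C u ≡ code C v
  code-cong C same = cong toℕ (encode-cong same)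

  -- In a bicoloring cover, each colour class (a fibre of the code) is independent:
  -- an edge inside it would be monochromatic under every colouring.
  colour-class-independent : ∀ {m} (E : Hypergraph n) (C : Fin m → Bicoloring n) →
                             IsBicoloringCover E m C → ∀ c → Independent E (fibre (code C) c)
  colour-class-independent E C cover c e edge e⊆class with cover e edge
  ... | i , u , v , u∈e , v∈e , split =
    split (code-injective C (trans (∈⟦⟧⁻ (λ j → code C j ≟ c) (e⊆class u∈e))
                                   (sym (∈⟦⟧⁻ (λ j → code C j ≟ c) (e⊆class v∈e)))) i)

  split-or-uniform : ∀ {m} (C : Fin m → Bicoloring n) (e : Subset n) {u₀} → u₀ ∈ e →
                     (∃[ i ] NonMonochromatic (C i) e) ⊎ (∀ {v} → v ∈ e → ∀ i → C i u₀ ≡ C i v)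
  split-or-uniform C e {u₀} u₀∈e with any? (λ i → any? (λ v → (v ∈? e) ×-dec ¬? (C i u₀ ≟ᵇ C i v)))
  ... | yes (i , v , v∈e , split) = inj₁ (i , u₀ , v , u₀∈e , v∈e , split)
  ... | no  noSplit              = inj₂ λ {v} v∈e i →
    decidable-stable (C i u₀ ≟ᵇ C i v) λ split → noSplit (i , v , v∈e , split)

open Colourings

-- The hypergraph of the theorem, for p = b + 2 and q = 2^z.
-- Vertex j lies in row ⌊j/q⌋ and column j mod q; V1 is the first a = p-1 rows, V2 the last.
module Construction (b z : ℕ) where

  a p q n : ℕ
  a = suc b
  p = suc a
  q = 2 ^ z
  n = p * q

  instance
    q≢0 : NonZero q
    q≢0 = m^n≢0 2 z

  G : Hypergraph n
  G = Gq n q p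

  V1 V2 : Subset n
  V1 = ⟦ (λ j → toℕ j <? n ∸ q) ⟧
  V2 = ∁ V1

  n∸q≡a*q : n ∸ q ≡ a * q
  n∸q≡a*q = m+n∸m≡n q (a * q)

  ∈V1⁺ : ∀ {j} → InV1 q j → j ∈ V1
  ∈V1⁺ = ∈⟦⟧⁺ (λ j → toℕ j <? n ∸ q)

  ∈V1⁻ : ∀ {j} → j ∈ V1 → InV1 q j
  ∈V1⁻ = ∈⟦⟧⁻ (λ j → toℕ j <? n ∸ q)

  ∈V1⇒<a*q : ∀ {j} → j ∈ V1 → toℕ j < a * q
  ∈V1⇒<a*q {j} j∈V1 = subst (toℕ j <_) n∸q≡a*q (∈V1⁻ j∈V1)

  ∈V2⁻ : ∀ {j} → j ∈ V2 → ¬ InV1 q j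
  ∈V2⁻ j∈V2 = x∈∁p⇒x∉p j∈V2 ∘ ∈V1⁺

  ∈V2⇒a*q≤ : ∀ {j} → j ∈ V2 → a * q ≤ toℕ j
  ∈V2⇒a*q≤ {j} j∈V2 = subst (_≤ toℕ j) n∸q≡a*q (≮⇒≥ (∈V2⁻ j∈V2))

  ∣V1∣ : ∣ V1 ∣ ≡ a * q
  ∣V1∣ = trans (∣below∣ (n ∸ q) (m∸n≤m n q)) n∸q≡a*q

  ∣V2∣ : ∣ V2 ∣ ≡ q
  ∣V2∣ = trans (∣∁p∣≡n∸∣p∣ V1) (trans (cong (n ∸_) ∣V1∣) (m+n∸n≡m q (a * q)))

  ∣edge∣ : ∀ {e} → G e → ∣ e ∣ ≡ p
  ∣edge∣ (inj₁ (∣e∣ , _) , _) = ∣e∣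
  ∣edge∣ (inj₂ (∣e∣ , _) , _) = ∣e∣

  edge-V2 : ∀ {e} → G e → ∣ e ∩ V2 ∣ ≤ 1
  edge-V2 {e} (inj₁ (_ , inside) , _) = ∣S∣≤1 (e ∩ V2) λ {u} u∈ _ →
    let (u∈e , u∈V2) = x∈p∩q⁻ e V2 u∈ in contradiction (inside u u∈e) (∈V2⁻ u∈V2)
  edge-V2 {e} (inj₂ (_ , w , _ , _ , unique) , _) = ∣S∣≤1 (e ∩ V2) λ {u} {v} u∈ v∈ →
    let (u∈e , u∈V2) = x∈p∩q⁻ e V2 u∈
        (v∈e , v∈V2) = x∈p∩q⁻ e V2 v∈
    in trans (unique u u∈e (∈V2⁻ u∈V2)) (sym (unique v v∈e (∈V2⁻ v∈V2)))

  -- A p-set inside V1 is never an E3 set: a residue class meets V1 in only a = p-1 vertices.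
  V1-not-E3 : ∀ {T} → T ⊆ V1 → ¬ E3 n q p T
  V1-not-E3 {T} T⊆V1 (∣T∣≡p , r , _ , residue) =
    <-irrefl refl (subst (_≤ a) ∣T∣≡p (congruent-bound q a r T (∈V1⇒<a*q ∘ T⊆V1) (residue _)))

  -- Hence an independent set inside V1 has at most p-1 vertices: any p of them form an E1 edge.
  V1-bound : ∀ {S} → Independent G S → S ⊆ V1 → ∣ S ∣ ≤ a
  V1-bound {S} independent S⊆V1 = ≮⇒≥ λ a<∣S∣ → no-p-subset (choose S p a<∣S∣)
    where
      no-p-subset : ¬ (∃[ T ] (T ⊆ S × ∣ T ∣ ≡ p))
      no-p-subset (T , T⊆S , ∣T∣≡p) = independent T (inj₁ E1-edge , V1-not-E3 (S⊆V1 ∘ T⊆S)) T⊆S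
        where
          E1-edge : E1 n q p T
          E1-edge = ∣T∣≡p , λ j j∈T → ∈V1⁻ (S⊆V1 (T⊆S j∈T))

  -- A vertex of V2 is a·q plus its residue, so residues separate the vertices of V2.
  V2-residue : ∀ {j} → j ∈ V2 → toℕ j % q ≡ toℕ j ∸ a * q
  V2-residue {j} j∈V2 = begin
    toℕ j % q                      ≡⟨ cong (_% q) (m∸n+n≡m (∈V2⇒a*q≤ j∈V2)) ⟨
    (toℕ j ∸ a * q + a * q) % q    ≡⟨ [m+kn]%n≡m%n (toℕ j ∸ a * q) a q ⟩
    (toℕ j ∸ a * q) % q            ≡⟨ m<n⇒m%n≡m (m<n+o⇒m∸n<o (toℕ j) (a * q) j<a*q+q) ⟩
    toℕ j ∸ a * q                  ∎
    where
      open ≡-Reasoning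
      j<a*q+q : toℕ j < a * q + q
      j<a*q+q = subst (toℕ j <_) (+-comm q (a * q)) (toℕ<n j)

  V2-injective : ∀ {u v} → u ∈ V2 → v ∈ V2 → toℕ u % q ≡ toℕ v % q → u ≡ v
  V2-injective u∈V2 v∈V2 same = toℕ-injective (∸-cancelʳ-≡ (∈V2⇒a*q≤ u∈V2) (∈V2⇒a*q≤ v∈V2)
    (trans (sym (V2-residue u∈V2)) (trans same (V2-residue v∈V2))))

  E2-completion : ∀ {W u} → W ⊆ V1 → ∣ W ∣ ≡ a → u ∈ V2 → E2 n q p (W ∪ ⁅ u ⁆)
  E2-completion {W} {u} W⊆V1 ∣W∣≡a u∈V2 = size , u , x∈p∪q⁺ (inj₂ (x∈⁅x⁆ u)) , ∈V2⁻ u∈V2 , unique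
    where
      disjoint : ∀ {j} → j ∈ W → j ∉ ⁅ u ⁆
      disjoint j∈W j∈⁅u⁆ = x∈∁p⇒x∉p u∈V2 (subst (_∈ V1) (x∈⁅y⁆⇒x≡y u j∈⁅u⁆) (W⊆V1 j∈W))
      size : ∣ W ∪ ⁅ u ⁆ ∣ ≡ p
      size = trans (∣∪∣-disjoint W ⁅ u ⁆ disjoint) (trans (cong₂ _+_ ∣W∣≡a (∣⁅x⁆∣≡1 u)) (+-comm a 1))
      unique : ∀ w → w ∈ W ∪ ⁅ u ⁆ → ¬ InV1 q w → w ≡ u
      unique w w∈ outside with x∈p∪q⁻ W ⁅ u ⁆ w∈
      ... | inj₁ w∈W   = contradiction (∈V1⁻ (W⊆V1 w∈W)) outside
      ... | inj₂ w∈⁅u⁆ = x∈⁅y⁆⇒x≡y u w∈⁅u⁆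

  -- If an independent K has p-1 vertices in V1, it has at most one in V2: each u ∈ K ∩ V2
  -- completes K ∩ V1 to an E2 edge inside K, which must then lie in E3, so u shares the
  -- residue of any w ∈ K ∩ V1; and residues separate V2.
  full-V1⇒V2-bound : ∀ {K} → Independent G K → ∣ K ∩ V1 ∣ ≡ a → ∣ K ∩ V2 ∣ ≤ 1
  full-V1⇒V2-bound {K} independent full with nonempty (K ∩ V1) (subst (0 <_) (sym full) z<s)
  ... | w , w∈K∩V1 = ∣S∣≤1 (K ∩ V2) λ u∈ v∈ →
    V2-injective (in-V2 u∈) (in-V2 v∈) (trans (residue-of-w u∈) (sym (residue-of-w v∈)))
    where
      in-V2 : ∀ {u} → u ∈ K ∩ V2 → u ∈ V2
      in-V2 = proj₂ ∘ x∈p∩q⁻ K V2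
      residue-of-w : ∀ {u} → u ∈ K ∩ V2 → toℕ u % q ≡ toℕ w % q
      residue-of-w {u} u∈ = decidable-stable (toℕ u % q ≟ toℕ w % q) λ differ →
        independent (K ∩ V1 ∪ ⁅ u ⁆)
          ( inj₂ (E2-completion (p∩q⊆q K V1) full (in-V2 u∈))
          , λ (_ , r , _ , residue) →
              differ (trans (residue u (x∈p∪q⁺ (inj₂ (x∈⁅x⁆ u)))) (sym (residue w (x∈p∪q⁺ (inj₁ w∈K∩V1))))))
          (∪⁅⁆⊆ (p∩q⊆p K V1) (proj₁ (x∈p∩q⁻ K V2 u∈)))

  independent-dichotomy : ∀ {K} → Independent G K → ∣ K ∣ ≤ p ⊎ ∣ K ∩ V1 ∣ ≤ b
  independent-dichotomy {K} independent with ∣ K ∩ V1 ∣ ≟ a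
  ... | yes full = inj₁ (begin
        ∣ K ∣                    ≡⟨ ∣∩∣+∣∩∁∣ K V1 ⟩
        ∣ K ∩ V1 ∣ + ∣ K ∩ V2 ∣  ≤⟨ +-mono-≤ (≤-reflexive full) (full-V1⇒V2-bound independent full) ⟩
        a + 1                    ≡⟨ +-comm a 1 ⟩
        p                        ∎)
    where open ≤-Reasoning
  ... | no ¬full = inj₂ (s≤s⁻¹ (≤∧≢⇒< ∣K∩V1∣≤a ¬full))
    where
      ∣K∩V1∣≤a : ∣ K ∩ V1 ∣ ≤ a
      ∣K∩V1∣≤a = V1-bound (independent-⊆ G (p∩q⊆p K V1) independent) (p∩q⊆q K V1)

  independent-upper : 2 ≤ q → ∀ {I} → Independent G I → ∣ I ∣ ≤ q + b
  independent-upper 2≤q {I} independent with independent-dichotomy independent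
  ... | inj₁ ∣I∣≤p = ≤-trans ∣I∣≤p (+-monoˡ-≤ b 2≤q)
  ... | inj₂ few   = begin
        ∣ I ∣                    ≡⟨ ∣∩∣+∣∩∁∣ I V1 ⟩
        ∣ I ∩ V1 ∣ + ∣ I ∩ V2 ∣  ≤⟨ +-mono-≤ few (subst (∣ I ∩ V2 ∣ ≤_) ∣V2∣ (∣p∩q∣≤∣q∣ I V2)) ⟩
        b + q                    ≡⟨ +-comm b q ⟩
        q + b                    ∎
    where open ≤-Reasoning

  -- Lower bound for α: p-2 vertices of V1 together with all of V2 are independent, since an edge
  -- meets them in at most (p-2) + 1 vertices.
  large-independent : ∃[ I ] (Independent G I × ∣ I ∣ ≡ q + b)
  large-independent with choose V1 b (subst (b ≤_) (sym ∣V1∣) (≤-trans (n≤1+n b) (m≤m*n a q)))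
  ... | T , T⊆V1 , ∣T∣≡b = T ∪ V2 , independent , size
    where
      size : ∣ T ∪ V2 ∣ ≡ q + b
      size = trans (∣∪∣-disjoint T V2 (x∈p⇒x∉∁p ∘ T⊆V1)) (trans (cong₂ _+_ ∣T∣≡b ∣V2∣) (+-comm b q))
      independent : Independent G (T ∪ V2)
      independent e edge e⊆ = <⇒≱ (subst (_< p) (+-comm 1 b) (n<1+n a)) (begin
        p                        ≡⟨ ∣edge∣ edge ⟨
        ∣ e ∣                    ≡⟨ ∣∩∣+∣∩∁∣ e V1 ⟩
        ∣ e ∩ V1 ∣ + ∣ e ∩ V2 ∣  ≤⟨ +-mono-≤ (subst (∣ e ∩ V1 ∣ ≤_) ∣T∣≡b (p⊆q⇒∣p∣≤∣q∣ e∩V1⊆T)) (edge-V2 edge) ⟩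
        b + 1                    ∎)
        where
          open ≤-Reasoning
          e∩V1⊆T : e ∩ V1 ⊆ T
          e∩V1⊆T j∈ with x∈p∩q⁻ e V1 j∈
          ... | j∈e , j∈V1 with x∈p∪q⁻ T V2 (e⊆ j∈e)
          ... | inj₁ j∈T  = j∈T
          ... | inj₂ j∈V2 = contradiction j∈V1 (x∈∁p⇒x∉p j∈V2)

  independence-number : 2 ≤ q → IsIndependenceNumber G (q + p ∸ 2)
  independence-number 2≤q = subst (IsIndependenceNumber G) (sym (+-∸-assoc q (s≤s (s≤s z≤n))))
    (large-independent , λ I → independent-upper 2≤q)

  -- Upper bound for χ^c: colour vertex j by the binary digits of its residue mod q.
  residue : Fin n → Fin q
  residue j = toℕ j mod q

  toℕ-residue : ∀ j → toℕ (residue j) ≡ toℕ j % q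
  toℕ-residue j = toℕ-fromℕ< (m%n<n (toℕ j) q)

  residue-cover : Fin z → Bicoloring n
  residue-cover i j = digits z (residue j) i

  same-digits⇒same-residue : ∀ {u v} → (∀ i → residue-cover i u ≡ residue-cover i v) →
                             toℕ u % q ≡ toℕ v % q
  same-digits⇒same-residue {u} {v} same =
    trans (sym (toℕ-residue u)) (trans (cong toℕ (digits-injective z same)) (toℕ-residue v))

  -- An edge monochromatic under every digit would lie in one residue class, i.e. in E3.
  residue-cover-isCover : IsBicoloringCover G z residue-cover
  residue-cover-isCover e edge with nonempty e (subst (0 <_) (sym (∣edge∣ edge)) z<s)
  ... | u₀ , u₀∈e with split-or-uniform residue-cover e u₀∈e
  ... | inj₁ split   = split
  ... | inj₂ uniform = contradiction
    (∣edge∣ edge , toℕ u₀ % q , m%n<n (toℕ u₀) q , λ j j∈e → sym (same-digits⇒same-residue (uniform j∈e)))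
    (proj₂ edge)

  class-V1-bound : ∀ {m} {C : Fin m → Bicoloring n} → IsBicoloringCover G m C →
                   ∀ c → ∣ V1 ∩ fibre (code C) c ∣ ≤ a
  class-V1-bound {C = C} cover c = V1-bound
    (independent-⊆ G (p∩q⊆q V1 _) (colour-class-independent G C cover c)) (p∩q⊆p V1 _)

  -- Lower bound for χ^c: counting V1 over the 2^m colour classes gives a·q ≤ 2^m·a, so q ≤ 2^m.
  cover-lower : ∀ {m} {C : Fin m → Bicoloring n} → IsBicoloringCover G m C → z ≤ m
  cover-lower {m} {C} cover = ≮⇒≥ λ m<z → <⇒≱ (^-monoʳ-< 2 (s≤s (s≤s z≤n)) m<z) q≤2^m
    where
      q≤2^m : q ≤ 2 ^ m
      q≤2^m = *-cancelʳ-≤ q (2 ^ m) a (begin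
        q * a     ≡⟨ *-comm q a ⟩
        a * q     ≡⟨ ∣V1∣ ⟨
        ∣ V1 ∣    ≤⟨ fibre-bound (2 ^ m) (code C) V1 (λ {j} _ → code<2^m C j) (λ c _ → class-V1-bound cover c) ⟩
        2 ^ m * a ∎)
        where open ≤-Reasoning

  cover-number : IsCoverNumber G z
  cover-number = (residue-cover , residue-cover-isCover) , λ m C cover → cover-lower cover

  optimal-size : ∀ {c} → IsCoverNumber G c → c ≡ z
  optimal-size ((C , cover) , minimal) =
    ≤-antisym (minimal z residue-cover residue-cover-isCover) (cover-lower cover)

  -- Upper bound for γ: under a cover with z colourings the q colour classes each meet V1 in at
  -- most p-1 of its (p-1)q vertices, hence in exactly p-1; the dichotomy then bounds each class by p.
  colour-class-bound : ∀ {C : Fin z → Bicoloring n} → IsBicoloringCover G z C →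
                       ∀ {c} → c < q → ∣ fibre (code C) c ∣ ≤ p
  colour-class-bound {C} cover {c} c<q with independent-dichotomy (colour-class-independent G C cover c)
  ... | inj₁ ∣K∣≤p = ∣K∣≤p
  ... | inj₂ few   = contradiction (≤-trans meets-V1 (subst (_≤ b) (cong ∣_∣ (∩-comm _ V1)) few)) (<-irrefl refl)
    where
      meets-V1 : a ≤ ∣ V1 ∩ fibre (code C) c ∣
      meets-V1 = fibre-full q (code C) V1 (λ {j} _ → code<2^m C j) (λ c _ → class-V1-bound cover c)
                   (≤-reflexive (trans (*-comm q a) (sym ∣V1∣))) c<q

  -- A set with a common bit vector lies in one colour class, so it has at most p vertices.
  same-bit-vector-bound : ∀ {C : Fin z → Bicoloring n} → IsBicoloringCover G z C →
                          ∀ S → SameBitVector C S → ∣ S ∣ ≤ p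
  same-bit-vector-bound {C} cover S same with nonempty? S
  ... | no empty        = ≤-trans (≤-reflexive (∣Empty∣≡0 empty)) z≤n
  ... | yes (u₀ , u₀∈S) = ≤-trans (p⊆q⇒∣p∣≤∣q∣ S⊆class) (colour-class-bound cover (code<2^m C u₀))
    where
      S⊆class : S ⊆ fibre (code C) (code C u₀)
      S⊆class {v} v∈S = ∈⟦⟧⁺ (λ j → code C j ≟ code C u₀) (code-cong C (same v u₀ v∈S u₀∈S))

  -- The residue class of 0 has p vertices: the q classes have at most p of the pq vertices each.
  residue-class-0 : p ≤ ∣ ⊤ {n} ∩ fibre (λ j → toℕ j % q) 0 ∣
  residue-class-0 = fibre-full q (λ j → toℕ j % q) (⊤ {n}) (λ {j} _ → m%n<n (toℕ j) q)
    (λ r _ → congruent-bound q p r _ (λ {j} _ → toℕ<n j) (in-class r))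
    (≤-reflexive (trans (*-comm q p) (sym (∣⊤∣≡n n)))) (m^n>0 2 z)
    where
      in-class : ∀ r {j} → j ∈ ⊤ {n} ∩ fibre (λ j → toℕ j % q) r → toℕ j % q ≡ r
      in-class r j∈ = ∈⟦⟧⁻ (λ j → toℕ j % q ≟ r) (proj₂ (x∈p∩q⁻ (⊤ {n}) _ j∈))

  -- Lower bound for γ: p vertices of residue 0 share their bit vector under the residue cover.
  optimal-cover-witness : ∃[ C ] ∃[ S ] (IsBicoloringCover G z C × SameBitVector C S × ∣ S ∣ ≡ p)
  optimal-cover-witness with choose (⊤ {n} ∩ fibre (λ j → toℕ j % q) 0) p residue-class-0
  ... | S , S⊆class , ∣S∣≡p = residue-cover , S , residue-cover-isCover , same , ∣S∣≡p
    where
      residue-0 : ∀ {j} → j ∈ S → toℕ (residue j) ≡ 0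
      residue-0 {j} j∈S =
        trans (toℕ-residue j) (∈⟦⟧⁻ (λ j → toℕ j % q ≟ 0) (proj₂ (x∈p∩q⁻ (⊤ {n}) _ (S⊆class j∈S))))
      same : SameBitVector residue-cover S
      same u v u∈S v∈S i =
        cong (λ x → digits z x i) (toℕ-injective (trans (residue-0 u∈S) (sym (residue-0 v∈S))))

  cover-independence-number : IsCoverIndependenceNumber G p
  cover-independence-number c optimal with optimal-size optimal
  ... | refl = optimal-cover-witness , λ C S cover same → same-bit-vector-bound cover S same

-- For p ≥ 3 take b = p - 2; z ≥ 1 gives q = 2^z ≥ 2, and ⌈log₂ 2^z⌉ = z.
theorem9 : (p z : ℕ) → 0 < z → 2 < p → p < 2 ^ z →
    IsCoverNumber (Gq (p * 2 ^ z) (2 ^ z) p {{m^n≢0 2 z}}) ⌈log₂ 2 ^ z ⌉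
    × IsIndependenceNumber (Gq (p * 2 ^ z) (2 ^ z) p {{m^n≢0 2 z}}) (2 ^ z + p ∸ 2)
    × IsCoverIndependenceNumber (Gq (p * 2 ^ z) (2 ^ z) p {{m^n≢0 2 z}}) p
theorem9 0             z 0<z ()            _
theorem9 1             z 0<z (s≤s ())      _
theorem9 (suc (suc b)) z 0<z _             _ =
    subst (IsCoverNumber G) (sym (⌈log₂2^n⌉≡n z)) cover-number
  , independence-number (^-monoʳ-≤ 2 0<z)
  , cover-independence-number
  where open Construction b z
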